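{- For every integer $n\ge 4$ and every integer $i$ with $\lceil\frac{n}{3}\rceil\le i\le n$, the number $|\mathcal{C}_n^i|$ equals the coefficient of $u^nv^i$ in the power series expansion of \[f(u,v)=\frac{u^4v^2\,(6+4v+v^2+5u+4uv+uv^2+3u^2+3u^2v+u^2v^2)}{1-uv-u^2v-u^3v}.\]
   Context: For an integer $m\ge 3$, $C_m$ denotes the cycle with vertex set $[m]=\{1,2,\dots,m\}$ and edge set $\{\{1,2\},\{2,3\},\dots,\{m-1,m\},\{m,1\}\}$. A set $S$ of vertices of a graph $G$ is a dominating set if every vertex not in $S$ is adjacent to at least one vertex of $S$. $\mathcal{C}_m^j$ denotes the family of dominating sets of $C_m$ of cardinality $j$. $\lceil x\rceil$ is the least integer $\ge x$. -}

module Defs where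

open import Data.Nat using (ℕ; zero; suc; _+_; _*_; _∸_; _≤_; _≟_)
open import Data.Nat.DivMod using (_%_)
open import Data.Fin using (Fin; toℕ)
open import Data.Fin.Subset using (Subset; _∈_; _∉_; ∣_∣; inside; outside)
open import Data.Fin.Subset.Properties using (_∈?_)
open import Data.Fin.Properties using (all?; any?)
open import Data.Vec using ([]; _∷_)
open import Data.List using (List; []; _∷_; _++_; map; filter; length; upTo)
open import Data.Nat.ListAction using (sum)
open import Data.Product using (∃; _×_; _,_)
open import Data.Sum using (_⊎_)
open import Relation.Binary.PropositionalEquality using (_≡_)
open import Relation.Nullary using (Dec; yes; no; ¬_)
open import Relation.Nullary.Decidable using (_×-dec_; _⊎-dec_; ¬?; _→-dec_)

-- The cycle C_m on vertex set Fin m.  Vertex k : Fin m stands for the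
-- vertex (toℕ k + 1) of [m]; the edges {j, j+1} (indices mod m) are
-- exactly those of C_m = {{1,2},…,{m-1,m},{m,1}}.

CycleAdj : (m : ℕ) → Fin m → Fin m → Set
CycleAdj zero    u v = suc (toℕ u) ≡ toℕ v ⊎ suc (toℕ v) ≡ toℕ u
CycleAdj (suc m) u v =
  (suc (toℕ u) % suc m) ≡ toℕ v ⊎ (suc (toℕ v) % suc m) ≡ toℕ u

cycleAdj? : (m : ℕ) → (u v : Fin m) → Dec (CycleAdj m u v)
cycleAdj? zero    u v = (suc (toℕ u) ≟ toℕ v) ⊎-dec (suc (toℕ v) ≟ toℕ u)
cycleAdj? (suc m) u v =
  ((suc (toℕ u) % suc m) ≟ toℕ v) ⊎-dec ((suc (toℕ v) % suc m) ≟ toℕ u)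

IsDominating : (m : ℕ) → Subset m → Set
IsDominating m S = ∀ v → v ∉ S → ∃ λ u → CycleAdj m u v × u ∈ S

isDominating? : (m : ℕ) → (S : Subset m) → Dec (IsDominating m S)
isDominating? m S =
  all? λ v → ¬? (v ∈? S) →-dec any? λ u → cycleAdj? m u v ×-dec (u ∈? S)

allSubsets : (m : ℕ) → List (Subset m)
allSubsets zero    = [] ∷ []
allSubsets (suc m) = map (inside ∷_) (allSubsets m) ++ map (outside ∷_) (allSubsets m)

numDominatingSets : (m j : ℕ) → ℕ
numDominatingSets m j =
  length (filter (λ S → isDominating? m S ×-dec (∣ S ∣ ≟ j)) (allSubsets m))

-- Formal power series in u, v with ℕ coefficients:
-- F n i is the coefficient of u^n v^i.

Series : Set
Series = ℕ → ℕ → ℕ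

Σ≤ : ℕ → (ℕ → ℕ) → ℕ
Σ≤ n f = sum (map f (upTo (suc n)))

_⊗_ : Series → Series → Series
(F ⊗ G) n i = Σ≤ n λ a → Σ≤ i λ b → F a b * G (n ∸ a) (i ∸ b)

one : Series
one zero zero = 1
one _    _    = 0

_^ˢ_ : Series → ℕ → Series
F ^ˢ zero  = one
F ^ˢ suc k = F ⊗ (F ^ˢ k)

mono : ℕ → ℕ → ℕ → Series
mono c a b n i with n ≟ a | i ≟ b
... | yes _ | yes _ = c
... | _     | _     = 0

_⊕_ : Series → Series → Series
(F ⊕ G) n i = F n i + G n i

-- Geometric series 1/(1 - P) = Σ_{k≥0} P^k, for a series P every
-- monomial of which has u-degree ≥ 1 (so P^k contributes to the
-- coefficient of u^n only when k ≤ n; the sum below is therefore the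
-- full, untruncated coefficient).
geom : Series → Series
geom P n i = Σ≤ n λ k → (P ^ˢ k) n i

denomP : Series
denomP = mono 1 1 1 ⊕ (mono 1 2 1 ⊕ mono 1 3 1)

numer : Series
numer = mono 6 4 2 ⊕ (mono 4 4 3 ⊕ (mono 1 4 4 ⊕ (mono 5 5 2 ⊕ (mono 4 5 3
      ⊕ (mono 1 5 4 ⊕ (mono 3 6 2 ⊕ (mono 3 6 3 ⊕ mono 1 6 4)))))))

fSeries : Series
fSeries = numer ⊗ geom denomP

module Submission where

-- Let d_n be the weight enumerator (in v) of the dominating sets of C_n and f_n the coefficient of u^n
-- in f. Both satisfy X_{n+3} = v (X_{n+2} + X_{n+1} + X_n) for n ≥ 6, so it suffices that they agree
-- for 4 ≤ n ≤ 8, which is a finite computation.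
-- For f: 1/(1 - uv - u²v - u³v) counts compositions into parts 1, 2, 3 and satisfies the recurrence
-- for all n ≥ 0; multiplying by a numerator of u-degree 6 preserves it from n = 6 on.
-- For d_n: a set is dominating iff its cyclic indicator word has no three consecutive zeros. Fixing the
-- first two letters a b expresses d_n, for n ≥ 4, through the counts t_m of words y of length m with
-- 1 1 y a b free of 000, and appending one letter at a time shows that each t_m satisfies the recurrence.

open import Defs
open import Data.Bool using (Bool; true; false; _∨_; T)
open import Data.Bool.Properties using (T-∨; T-≡; T?)
open import Data.Fin using (Fin; toℕ) renaming (zero to fzero; suc to fsuc)
open import Data.Fin.Properties using (toℕ-fromℕ<; toℕ-injective; toℕ<n; all?)
open import Data.Fin.Subset using (Subset; _∈_; ∣_∣; inside; outside)
open import Data.Fin.Subset.Properties using (_∈?_)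
open import Data.List using (List; []; _∷_; _++_; map; filter; length; upTo)
open import Data.List.Properties using (map-applyUpTo; map-upTo; filter-++; filter-≐; filter-none; length-++)
import Data.List.Relation.Unary.All as All
open import Data.Nat
  using (ℕ; zero; suc; _+_; _*_; _∸_; _/_; _≤_; _<_; _⊔_; z≤n; s≤s; _≟_; _≤?_; _<?_; NonZero)
open import Data.Nat.DivMod
  using (_%_; _mod_; m<n⇒m%n≡m; n%n≡0; m%n<n; m%n%n≡m%n; %-distribˡ-+; [m+n]%n≡m%n; %-congˡ)
open import Data.Nat.Induction using (<-rec)
open import Data.Nat.ListAction using (sum)
open import Data.Nat.Properties
open import Algebra.Properties.CommutativeSemigroup +-commutativeSemigroup using (interchange)
open import Data.Product using (_×_; _,_; proj₁; proj₂; ∃)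
import Data.Product as Product
open import Data.Sum using (_⊎_; inj₁; inj₂)
import Data.Sum as Sum
open import Data.Unit using (⊤; tt)
open import Data.Vec using (Vec; toList; lookup) renaming ([] to []ᵥ; _∷_ to _∷ᵥ_)
open import Data.Vec.Properties using ([]=⇒lookup; lookup⇒[]=; length-toList)
open import Function using (_∘_; _⇔_; mk⇔; Equivalence)
open import Function.Properties.Equivalence using () renaming (trans to ⇔-trans; sym to ⇔-sym)
open import Relation.Binary.PropositionalEquality
open import Relation.Nullary using (Dec; yes; no; ¬_; contradiction)
open import Relation.Nullary.Decidable using (_×-dec_; from-yes)
open import Relation.Unary using (Decidable; _≐_)

open ≡-Reasoning
open Equivalence using (to; from)

sum-map-+ : ∀ {A : Set} (f g : A → ℕ) xs →
            sum (map (λ x → f x + g x) xs) ≡ sum (map f xs) + sum (map g xs)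
sum-map-+ f g []       = refl
sum-map-+ f g (x ∷ xs) = trans (cong (f x + g x +_) (sum-map-+ f g xs))
                               (interchange (f x) (g x) _ _)

sum-map-* : ∀ {A : Set} c (f : A → ℕ) xs → sum (map (λ x → c * f x) xs) ≡ c * sum (map f xs)
sum-map-* c f []       = sym (*-zeroʳ c)
sum-map-* c f (x ∷ xs) = trans (cong (c * f x +_) (sum-map-* c f xs))
                               (sym (*-distribˡ-+ c (f x) _))

Σ≤-suc : ∀ n f → Σ≤ (suc n) f ≡ f 0 + Σ≤ n (f ∘ suc)
Σ≤-suc n f = cong (λ xs → f 0 + sum xs)
  (trans (map-applyUpTo suc f (suc n)) (sym (map-upTo (f ∘ suc) (suc n))))

Σ≤-cong : ∀ n {f g} → (∀ k → k ≤ n → f k ≡ g k) → Σ≤ n f ≡ Σ≤ n g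
Σ≤-cong zero    eq = cong (_+ 0) (eq 0 z≤n)
Σ≤-cong (suc n) {f} {g} eq = begin
  Σ≤ (suc n) f            ≡⟨ Σ≤-suc n f ⟩
  f 0 + Σ≤ n (f ∘ suc)
    ≡⟨ cong₂ _+_ (eq 0 z≤n) (Σ≤-cong n (λ k k≤n → eq (suc k) (s≤s k≤n))) ⟩
  g 0 + Σ≤ n (g ∘ suc)    ≡⟨ Σ≤-suc n g ⟨
  Σ≤ (suc n) g            ∎

Σ≤-zero : ∀ n {f} → (∀ k → f k ≡ 0) → Σ≤ n f ≡ 0
Σ≤-zero zero    eq = cong (_+ 0) (eq 0)
Σ≤-zero (suc n) {f} eq = trans (Σ≤-suc n f) (cong₂ _+_ (eq 0) (Σ≤-zero n (eq ∘ suc)))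

Σ≤-+ : ∀ n f g → Σ≤ n (λ k → f k + g k) ≡ Σ≤ n f + Σ≤ n g
Σ≤-+ n f g = sum-map-+ f g (upTo (suc n))

Σ≤-* : ∀ n c f → Σ≤ n (λ k → c * f k) ≡ c * Σ≤ n f
Σ≤-* n c f = sum-map-* c f (upTo (suc n))

Σ≤-comm : ∀ m n (f : ℕ → ℕ → ℕ) →
          Σ≤ m (λ j → Σ≤ n (f j)) ≡ Σ≤ n (λ k → Σ≤ m (λ j → f j k))
Σ≤-comm zero    n f = trans (+-identityʳ _) (Σ≤-cong n (λ k _ → sym (+-identityʳ (f 0 k))))
Σ≤-comm (suc m) n f = begin
  Σ≤ (suc m) (λ j → Σ≤ n (f j))
    ≡⟨ Σ≤-suc m (λ j → Σ≤ n (f j)) ⟩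
  Σ≤ n (f 0) + Σ≤ m (λ j → Σ≤ n (f (suc j)))
    ≡⟨ cong (Σ≤ n (f 0) +_) (Σ≤-comm m n (f ∘ suc)) ⟩
  Σ≤ n (f 0) + Σ≤ n (λ k → Σ≤ m (λ j → f (suc j) k))
    ≡⟨ Σ≤-+ n (f 0) _ ⟨
  Σ≤ n (λ k → f 0 k + Σ≤ m (λ j → f (suc j) k))
    ≡⟨ Σ≤-cong n (λ k _ → Σ≤-suc m (λ j → f j k)) ⟨
  Σ≤ n (λ k → Σ≤ (suc m) (λ j → f j k))
    ∎

Σ≤-truncate : ∀ {m n f} → (∀ k → m < k → f k ≡ 0) → m ≤ n → Σ≤ n f ≡ Σ≤ m f
Σ≤-truncate {zero}  {zero}  vanish _ = refl
Σ≤-truncate {zero}  {suc n} {f} vanish _ =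
  trans (Σ≤-suc n f) (cong (f 0 +_) (Σ≤-zero n (λ k → vanish (suc k) (s≤s z≤n))))
Σ≤-truncate {suc m} {suc n} {f} vanish (s≤s m≤n) = begin
  Σ≤ (suc n) f             ≡⟨ Σ≤-suc n f ⟩
  f 0 + Σ≤ n (f ∘ suc)
    ≡⟨ cong (f 0 +_) (Σ≤-truncate (λ k m<k → vanish (suc k) (s≤s m<k)) m≤n) ⟩
  f 0 + Σ≤ m (f ∘ suc)     ≡⟨ Σ≤-suc m f ⟨
  Σ≤ (suc m) f             ∎

Poly : Set
Poly = ℕ → ℕ

shift : ℕ → Poly → Poly
shift zero    p k       = p k
shift (suc a) p zero    = 0
shift (suc a) p (suc k) = shift a p k

shift-cong : ∀ a {p q : Poly} → p ≗ q → shift a p ≗ shift a q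
shift-cong zero    eq k       = eq k
shift-cong (suc a) eq zero    = refl
shift-cong (suc a) eq (suc k) = shift-cong a eq k

shift-+ : ∀ a (p q : Poly) k → shift a p k + shift a q k ≡ shift a (λ j → p j + q j) k
shift-+ zero    p q k       = refl
shift-+ (suc a) p q zero    = refl
shift-+ (suc a) p q (suc k) = shift-+ a p q k

shift-* : ∀ a c (p : Poly) k → c * shift a p k ≡ shift a (λ j → c * p j) k
shift-* zero    c p k       = refl
shift-* (suc a) c p zero    = *-zeroʳ c
shift-* (suc a) c p (suc k) = shift-* a c p k

shift-shift : ∀ a b (p : Poly) k → shift a (shift b p) k ≡ shift (a + b) p k
shift-shift zero    b p k       = refl
shift-shift (suc a) b p zero    = refl
shift-shift (suc a) b p (suc k) = shift-shift a b p k

shift-comm : ∀ a b (p : Poly) k → shift a (shift b p) k ≡ shift b (shift a p) k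
shift-comm a b p k = begin
  shift a (shift b p) k  ≡⟨ shift-shift a b p k ⟩
  shift (a + b) p k      ≡⟨ cong (λ c → shift c p k) (+-comm a b) ⟩
  shift (b + a) p k      ≡⟨ shift-shift b a p k ⟨
  shift b (shift a p) k  ∎

Σ≤-supported : ∀ a n (h : ℕ → Poly) → (∀ k → k ≢ a → ∀ m → h k m ≡ 0) →
               Σ≤ n (λ k → h k (n ∸ k)) ≡ shift a (h a) n
Σ≤-supported zero zero h off = +-identityʳ (h 0 0)
Σ≤-supported zero (suc n) h off = begin
  Σ≤ (suc n) (λ k → h k (suc n ∸ k))       ≡⟨ Σ≤-suc n (λ k → h k (suc n ∸ k)) ⟩
  h 0 (suc n) + Σ≤ n (λ k → h (suc k) (n ∸ k))
    ≡⟨ cong (h 0 (suc n) +_) (Σ≤-zero n (λ k → off (suc k) (λ ()) (n ∸ k))) ⟩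
  h 0 (suc n) + 0                          ≡⟨ +-identityʳ _ ⟩
  h 0 (suc n)                              ∎
Σ≤-supported (suc a) zero h off = cong (_+ 0) (off 0 (λ ()) 0)
Σ≤-supported (suc a) (suc n) h off = begin
  Σ≤ (suc n) (λ k → h k (suc n ∸ k))             ≡⟨ Σ≤-suc n (λ k → h k (suc n ∸ k)) ⟩
  h 0 (suc n) + Σ≤ n (λ k → h (suc k) (n ∸ k))
    ≡⟨ cong (_+ Σ≤ n (λ k → h (suc k) (n ∸ k))) (off 0 (λ ()) (suc n)) ⟩
  Σ≤ n (λ k → h (suc k) (n ∸ k))
    ≡⟨ Σ≤-supported a n (h ∘ suc) (λ k k≢a → off (suc k) (k≢a ∘ suc-injective)) ⟩
  shift a (h (suc a)) n                          ∎

infixr 25 _·ˢ_ u^_·_ v^_·_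

_·ˢ_ : ℕ → Series → Series
(c ·ˢ F) n i = c * F n i

u^_·_ : ℕ → Series → Series
(u^ a · F) n i = shift a (λ m → F m i) n

v^_·_ : ℕ → Series → Series
(v^ b · F) n = shift b (F n)

⊗-⊕ˡ : ∀ A B F n i → ((A ⊕ B) ⊗ F) n i ≡ (A ⊗ F) n i + (B ⊗ F) n i
⊗-⊕ˡ A B F n i = trans (Σ≤-cong n (λ a _ → split a)) (Σ≤-+ n (inner A) (inner B))
  where
  term : Series → ℕ → ℕ → ℕ
  term C a b = C a b * F (n ∸ a) (i ∸ b)
  inner : Series → ℕ → ℕ
  inner C a = Σ≤ i (term C a)
  split : ∀ a → Σ≤ i (term (A ⊕ B) a) ≡ inner A a + inner B a
  split a = trans (Σ≤-cong i (λ b _ → *-distribʳ-+ (F (n ∸ a) (i ∸ b)) (A a b) (B a b)))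
                  (Σ≤-+ i (term A a) (term B a))

⊗-cong≤ : ∀ A {F G} n → (∀ m → m ≤ n → F m ≗ G m) → (A ⊗ F) n ≗ (A ⊗ G) n
⊗-cong≤ A n eq i =
  Σ≤-cong n (λ a _ → Σ≤-cong i (λ b _ → cong (A a b *_) (eq (n ∸ a) (m∸n≤m n a) (i ∸ b))))

⊗-cong< : ∀ A {F G} n → (∀ b → A 0 b ≡ 0) → (∀ m → m < n → F m ≗ G m) →
          (A ⊗ F) n ≗ (A ⊗ G) n
⊗-cong< A {F} {G} n A₀≡0 eq i = Σ≤-cong n (λ a a≤n → Σ≤-cong i (λ b _ → term a a≤n b))
  where
  term : ∀ a → a ≤ n → ∀ b → A a b * F (n ∸ a) (i ∸ b) ≡ A a b * G (n ∸ a) (i ∸ b)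
  term zero    _   b rewrite A₀≡0 b = refl
  term (suc a) a<n b = cong (A (suc a) b *_) (eq (n ∸ suc a) (∸-monoʳ-< (s≤s z≤n) a<n) (i ∸ b))

⊗-zeroʳ : ∀ A n i → (A ⊗ λ _ _ → 0) n i ≡ 0
⊗-zeroʳ A n i = Σ≤-zero n (λ a → Σ≤-zero i (λ b → *-zeroʳ (A a b)))

⊗-Σ≤ : ∀ A N (F : ℕ → Series) n i →
       Σ≤ N (λ k → (A ⊗ F k) n i) ≡ (A ⊗ λ m j → Σ≤ N (λ k → F k m j)) n i
⊗-Σ≤ A N F n i = begin
  Σ≤ N (λ k → Σ≤ n (λ a → Σ≤ i (λ b → A a b * F k (n ∸ a) (i ∸ b))))
    ≡⟨ Σ≤-comm N n _ ⟩
  Σ≤ n (λ a → Σ≤ N (λ k → Σ≤ i (λ b → A a b * F k (n ∸ a) (i ∸ b))))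
    ≡⟨ Σ≤-cong n (λ a _ → Σ≤-comm N i _) ⟩
  Σ≤ n (λ a → Σ≤ i (λ b → Σ≤ N (λ k → A a b * F k (n ∸ a) (i ∸ b))))
    ≡⟨ Σ≤-cong n (λ a _ → Σ≤-cong i (λ b _ → Σ≤-* N (A a b) _)) ⟩
  (A ⊗ λ m j → Σ≤ N (λ k → F k m j)) n i ∎

mono-on : ∀ c a b → mono c a b a b ≡ c
mono-on c a b with a ≟ a | b ≟ b
... | yes _   | yes _   = refl
... | no a≢a  | _       = contradiction refl a≢a
... | yes _   | no b≢b  = contradiction refl b≢b

mono-offᵘ : ∀ c a b {n} i → n ≢ a → mono c a b n i ≡ 0
mono-offᵘ c a b {n} i n≢a with n ≟ a | i ≟ b
... | yes n≡a | _     = contradiction n≡a n≢a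
... | no _    | yes _ = refl
... | no _    | no _  = refl

mono-offᵛ : ∀ c a b n {i} → i ≢ b → mono c a b n i ≡ 0
mono-offᵛ c a b n {i} i≢b with n ≟ a | i ≟ b
... | _     | yes i≡b = contradiction i≡b i≢b
... | yes _ | no _    = refl
... | no _  | no _    = refl

mono-⊗ : ∀ c a b F n i → (mono c a b ⊗ F) n i ≡ (u^ a · v^ b · c ·ˢ F) n i
mono-⊗ c a b F n i = begin
  Σ≤ n (λ k → Σ≤ i (λ l → mono c a b k l * F (n ∸ k) (i ∸ l)))
    ≡⟨ Σ≤-supported a n _ (λ k k≢a m →
         Σ≤-zero i (λ l → cong (_* F m (i ∸ l)) (mono-offᵘ c a b l k≢a))) ⟩
  shift a (λ m → Σ≤ i (λ l → mono c a b a l * F m (i ∸ l))) n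
    ≡⟨ shift-cong a (λ m → Σ≤-supported b i _ (λ l l≢b j →
         cong (_* F m j) (mono-offᵛ c a b a l≢b))) n ⟩
  shift a (λ m → shift b (λ j → mono c a b a b * F m j) i) n
    ≡⟨ shift-cong a (λ m → shift-cong b (λ j → cong (_* F m j) (mono-on c a b)) i) n ⟩
  (u^ a · v^ b · c ·ˢ F) n i ∎

infixr 6 _+ₘ_
infix 7 _·u^_v^_

data Monomials : Set where
  _·u^_v^_ : (c a b : ℕ) → Monomials
  _+ₘ_     : Monomials → Monomials → Monomials

⟦_⟧ : Monomials → Series
⟦ c ·u^ a v^ b ⟧ = mono c a b
⟦ s +ₘ t ⟧       = ⟦ s ⟧ ⊕ ⟦ t ⟧

mul : Monomials → Series → Series
mul (c ·u^ a v^ b) F = u^ a · v^ b · c ·ˢ F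
mul (s +ₘ t)       F = mul s F ⊕ mul t F

uDegree : Monomials → ℕ
uDegree (c ·u^ a v^ b) = a
uDegree (s +ₘ t)       = uDegree s ⊔ uDegree t

⊗-mul : ∀ s F n i → (⟦ s ⟧ ⊗ F) n i ≡ mul s F n i
⊗-mul (c ·u^ a v^ b) F n i = mono-⊗ c a b F n i
⊗-mul (s +ₘ t)       F n i =
  trans (⊗-⊕ˡ ⟦ s ⟧ ⟦ t ⟧ F n i) (cong₂ _+_ (⊗-mul s F n i) (⊗-mul t F n i))

-- The recurrence X_{n+3} = v (X_{n+2} + X_{n+1} + X_n)

sum₃ : Series → ℕ → Poly
sum₃ X n j = X (2 + n) j + (X (1 + n) j + X n j)

Rec : Series → ℕ → Set
Rec X n = X (3 + n) ≗ shift 1 (sum₃ X n)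

record RecFrom (n₀ : ℕ) (X : Series) : Set where
  constructor recFrom
  field rec : ∀ {n} → n₀ ≤ n → Rec X n
open RecFrom

RecFrom-mono : ∀ {m n X} → m ≤ n → RecFrom m X → RecFrom n X
RecFrom-mono m≤n recX = recFrom λ n≤k → rec recX (≤-trans m≤n n≤k)

sum₃-⊕ : ∀ F G k j → sum₃ (F ⊕ G) k j ≡ sum₃ F k j + sum₃ G k j
sum₃-⊕ F G k j =
  trans (cong (F (2 + k) j + G (2 + k) j +_) (interchange (F (1 + k) j) (G (1 + k) j) (F k j) (G k j)))
        (interchange (F (2 + k) j) (G (2 + k) j) _ _)

sum₃-·ˢ : ∀ c F k j → c * sum₃ F k j ≡ sum₃ (c ·ˢ F) k j
sum₃-·ˢ c F k j = trans (*-distribˡ-+ c _ _) (cong (c * F (2 + k) j +_) (*-distribˡ-+ c _ _))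

sum₃-v^ : ∀ b F k j → shift b (sum₃ F k) j ≡ sum₃ (v^ b · F) k j
sum₃-v^ b F k j = sym (trans (cong (shift b (F (2 + k)) j +_) (shift-+ b (F (1 + k)) (F k) j))
                             (shift-+ b (F (2 + k)) (λ j → F (1 + k) j + F k j) j))

rec-⊕ : ∀ {m n F G} → RecFrom m F → RecFrom n G → RecFrom (m ⊔ n) (F ⊕ G)
rec-⊕ {m} {n} {F} {G} recF recG = recFrom λ {k} m⊔n≤k i → begin
  F (3 + k) i + G (3 + k) i
    ≡⟨ cong₂ _+_ (rec recF (m⊔n≤o⇒m≤o m n m⊔n≤k) i)
                 (rec recG (m⊔n≤o⇒n≤o m n m⊔n≤k) i) ⟩
  shift 1 (sum₃ F k) i + shift 1 (sum₃ G k) i   ≡⟨ shift-+ 1 (sum₃ F k) (sum₃ G k) i ⟩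
  shift 1 (λ j → sum₃ F k j + sum₃ G k j) i    ≡⟨ shift-cong 1 (sum₃-⊕ F G k) i ⟨
  shift 1 (sum₃ (F ⊕ G) k) i                   ∎

rec-·ˢ : ∀ c {n₀ F} → RecFrom n₀ F → RecFrom n₀ (c ·ˢ F)
rec-·ˢ c {F = F} recF = recFrom λ {k} n₀≤k i → begin
  c * F (3 + k) i                    ≡⟨ cong (c *_) (rec recF n₀≤k i) ⟩
  c * shift 1 (sum₃ F k) i           ≡⟨ shift-* 1 c (sum₃ F k) i ⟩
  shift 1 (λ j → c * sum₃ F k j) i   ≡⟨ shift-cong 1 (sum₃-·ˢ c F k) i ⟩
  shift 1 (sum₃ (c ·ˢ F) k) i        ∎

rec-v^ : ∀ b {n₀ F} → RecFrom n₀ F → RecFrom n₀ (v^ b · F)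
rec-v^ b {F = F} recF = recFrom λ {k} n₀≤k i → begin
  shift b (F (3 + k)) i             ≡⟨ shift-cong b (rec recF n₀≤k) i ⟩
  shift b (shift 1 (sum₃ F k)) i    ≡⟨ shift-comm b 1 (sum₃ F k) i ⟩
  shift 1 (shift b (sum₃ F k)) i    ≡⟨ shift-cong 1 (sum₃-v^ b F k) i ⟩
  shift 1 (sum₃ (v^ b · F) k) i     ∎

rec-u^ : ∀ a {n₀ F} → RecFrom n₀ F → RecFrom (a + n₀) (u^ a · F)
rec-u^ zero    recF = recF
rec-u^ (suc a) recF = recFrom λ { (s≤s a+n₀≤n) → rec (rec-u^ a recF) a+n₀≤n }

rec-mul : ∀ s {n₀ F} → RecFrom n₀ F → RecFrom (uDegree s + n₀) (mul s F)
rec-mul (c ·u^ a v^ b) recF = rec-u^ a (rec-v^ b (rec-·ˢ c recF))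
rec-mul (s +ₘ t) {n₀} recF =
  RecFrom-mono (≤-reflexive (sym (+-distribʳ-⊔ n₀ (uDegree s) (uDegree t))))
               (rec-⊕ (rec-mul s recF) (rec-mul t recF))

module _ {X Y : Series} {l n₀ : ℕ} (l≤n₀ : l ≤ n₀) (recX : RecFrom n₀ X) (recY : RecFrom n₀ Y)
         (initial : ∀ {n} → l ≤ n → n < 3 + n₀ → X n ≗ Y n) where

  rec-unique : ∀ n → l ≤ n → X n ≗ Y n
  rec-unique = <-rec (λ n → l ≤ n → X n ≗ Y n) step
    where
    step : ∀ n → (∀ {m} → m < n → l ≤ m → X m ≗ Y m) → l ≤ n → X n ≗ Y n
    step zero             _ l≤n = initial l≤n (s≤s z≤n)
    step (suc zero)       _ l≤n = initial l≤n (s≤s (s≤s z≤n))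
    step (suc (suc zero)) _ l≤n = initial l≤n (s≤s (s≤s (s≤s z≤n)))
    step (suc (suc (suc m))) IH l≤n with n₀ ≤? m
    ... | no  n₀≰m = initial l≤n (s≤s (s≤s (s≤s (≰⇒> n₀≰m))))
    ... | yes n₀≤m = λ i → begin
      X (3 + m) i             ≡⟨ rec recX n₀≤m i ⟩
      shift 1 (sum₃ X m) i    ≡⟨ shift-cong 1 X≗Y i ⟩
      shift 1 (sum₃ Y m) i    ≡⟨ rec recY n₀≤m i ⟨
      Y (3 + m) i             ∎
      where
      l≤m = ≤-trans l≤n₀ n₀≤m
      X≗Y : sum₃ X m ≗ sum₃ Y m
      X≗Y j = cong₂ _+_ (IH (n<1+n (2 + m)) (m≤n⇒m≤1+n (m≤n⇒m≤1+n l≤m)) j)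
                        (cong₂ _+_ (IH (m<n⇒m<1+n (n<1+n (1 + m))) (m≤n⇒m≤1+n l≤m) j)
                                   (IH (m<n⇒m<1+n (m<n⇒m<1+n (n<1+n m))) l≤m j))

-- The generating function f

denomTerms numerTerms : Monomials
denomTerms = 1 ·u^ 1 v^ 1 +ₘ 1 ·u^ 2 v^ 1 +ₘ 1 ·u^ 3 v^ 1
numerTerms = 6 ·u^ 4 v^ 2 +ₘ 4 ·u^ 4 v^ 3 +ₘ 1 ·u^ 4 v^ 4 +ₘ 5 ·u^ 5 v^ 2 +ₘ 4 ·u^ 5 v^ 3
          +ₘ 1 ·u^ 5 v^ 4 +ₘ 3 ·u^ 6 v^ 2 +ₘ 3 ·u^ 6 v^ 3 +ₘ 1 ·u^ 6 v^ 4

denomP₀≡0 : ∀ b → denomP 0 b ≡ 0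
denomP₀≡0 b = refl

denomP-power-vanishes : ∀ k {m} j → m < k → (denomP ^ˢ k) m j ≡ 0
denomP-power-vanishes (suc k) {m} j m<1+k = begin
  (denomP ⊗ (denomP ^ˢ k)) m j  ≡⟨ ⊗-cong< denomP m denomP₀≡0 vanish j ⟩
  (denomP ⊗ λ _ _ → 0) m j      ≡⟨ ⊗-zeroʳ denomP m j ⟩
  0                             ∎
  where
  vanish : ∀ m′ → m′ < m → (denomP ^ˢ k) m′ ≗ λ _ → 0
  vanish m′ m′<m j′ = denomP-power-vanishes k j′ (<-≤-trans m′<m (≤-pred m<1+k))

geom-truncate : ∀ {m N} j → m ≤ N → Σ≤ N (λ k → (denomP ^ˢ k) m j) ≡ geom denomP m j
geom-truncate {m} j = Σ≤-truncate (λ k m<k → denomP-power-vanishes k j m<k)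

-- Summing one (vanishing) power further makes each inner sum below a full coefficient of geom.
geom-unfold : ∀ n i → geom denomP (suc n) i ≡ (denomP ⊗ geom denomP) (suc n) i
geom-unfold n i = begin
  geom denomP (suc n) i
    ≡⟨ geom-truncate i (n≤1+n (suc n)) ⟨
  Σ≤ (suc (suc n)) (λ k → (denomP ^ˢ k) (suc n) i)
    ≡⟨ Σ≤-suc (suc n) (λ k → (denomP ^ˢ k) (suc n) i) ⟩
  Σ≤ (suc n) (λ k → (denomP ⊗ (denomP ^ˢ k)) (suc n) i)
    ≡⟨ ⊗-Σ≤ denomP (suc n) (denomP ^ˢ_) (suc n) i ⟩
  (denomP ⊗ λ m j → Σ≤ (suc n) (λ k → (denomP ^ˢ k) m j)) (suc n) i
    ≡⟨ ⊗-cong≤ denomP (suc n) (λ m m≤1+n j → geom-truncate j m≤1+n) i ⟩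
  (denomP ⊗ geom denomP) (suc n) i
    ∎

-- trib n i counts the compositions of n into i parts from {1, 2, 3}.
trib : Series
trib zero                zero    = 1
trib zero                (suc i) = 0
trib (suc n)             zero    = 0
trib (suc zero)          (suc i) = trib 0 i
trib (suc (suc zero))    (suc i) = trib 1 i + trib 0 i
trib (suc (suc (suc n))) (suc i) = trib (2 + n) i + (trib (1 + n) i + trib n i)

rec-trib : RecFrom 0 trib
rec-trib = recFrom λ { _ zero → refl ; _ (suc i) → refl }

trib-unfold : ∀ n i → (denomP ⊗ trib) (suc n) i ≡ trib (suc n) i
trib-unfold n i = trans (⊗-mul denomTerms trib (suc n) i) (unfold n i)
  where
  unfold : ∀ n i → mul denomTerms trib (suc n) i ≡ trib (suc n) i
  unfold zero          zero    = refl
  unfold (suc zero)    zero    = refl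
  unfold (suc (suc n)) zero    = refl
  unfold zero          (suc i) = trans (+-identityʳ _) (*-identityˡ (trib 0 i))
  unfold (suc zero)    (suc i) =
    cong₂ _+_ (*-identityˡ (trib 1 i)) (trans (+-identityʳ _) (*-identityˡ (trib 0 i)))
  unfold (suc (suc n)) (suc i) =
    cong₂ _+_ (*-identityˡ (trib (2 + n) i))
              (cong₂ _+_ (*-identityˡ (trib (1 + n) i)) (*-identityˡ (trib n i)))

geom-trib : ∀ n → geom denomP n ≗ trib n
geom-trib = <-rec (λ n → geom denomP n ≗ trib n) step
  where
  step : ∀ n → (∀ {m} → m < n → geom denomP m ≗ trib m) → geom denomP n ≗ trib n
  step zero    _  zero    = refl
  step zero    _  (suc i) = refl
  step (suc n) IH i = begin
    geom denomP (suc n) i             ≡⟨ geom-unfold n i ⟩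
    (denomP ⊗ geom denomP) (suc n) i  ≡⟨ ⊗-cong< denomP (suc n) denomP₀≡0 (λ m → IH) i ⟩
    (denomP ⊗ trib) (suc n) i         ≡⟨ trib-unfold n i ⟩
    trib (suc n) i                    ∎

fSeries-expand : ∀ n i → fSeries n i ≡ mul numerTerms trib n i
fSeries-expand n i = trans (⊗-cong≤ numer n (λ m _ → geom-trib m) i) (⊗-mul numerTerms trib n i)

rec-numer : RecFrom 6 (mul numerTerms trib)
rec-numer = rec-mul numerTerms rec-trib

-- Words without three consecutive zeros

Covered : List Bool → Set
Covered (x ∷ y ∷ z ∷ w) = T (x ∨ y ∨ z) × Covered (y ∷ z ∷ w)
Covered _               = ⊤

covered? : Decidable Covered
covered? (x ∷ y ∷ z ∷ w) = T? (x ∨ y ∨ z) ×-dec covered? (y ∷ z ∷ w)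
covered? []              = yes tt
covered? (_ ∷ [])        = yes tt
covered? (_ ∷ _ ∷ [])    = yes tt

-- Past the end of the list `get` returns the junk value false; it is only read below the length.
get : List Bool → ℕ → Bool
get []       _       = false
get (x ∷ _)  zero    = x
get (_ ∷ xs) (suc j) = get xs j

window : List Bool → ℕ → Bool
window xs j = get xs j ∨ get xs (1 + j) ∨ get xs (2 + j)

covered⇒window : ∀ xs → Covered xs → ∀ {j} → 3 + j ≤ length xs → T (window xs j)
covered⇒window (x ∷ y ∷ z ∷ w) (xyz , _)  {zero}  _        = xyz
covered⇒window (x ∷ y ∷ z ∷ w) (_ , rest) {suc j} (s≤s le) = covered⇒window (y ∷ z ∷ w) rest le
covered⇒window (_ ∷ [])        _ (s≤s ())
covered⇒window (_ ∷ _ ∷ [])    _ (s≤s (s≤s ()))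

window⇒covered : ∀ xs → (∀ {j} → 3 + j ≤ length xs → T (window xs j)) → Covered xs
window⇒covered (x ∷ y ∷ z ∷ w) win =
  win (s≤s (s≤s (s≤s z≤n))) , window⇒covered (y ∷ z ∷ w) (win ∘ s≤s)
window⇒covered []              _   = tt
window⇒covered (_ ∷ [])        _   = tt
window⇒covered (_ ∷ _ ∷ [])    _   = tt

get-toList-++ˡ : ∀ {l} (y : Vec Bool l) r (u : Fin l) → get (toList y ++ r) (toℕ u) ≡ lookup y u
get-toList-++ˡ (x ∷ᵥ y) r fzero    = refl
get-toList-++ˡ (x ∷ᵥ y) r (fsuc u) = get-toList-++ˡ y r u

get-toList-++ʳ : ∀ {l} (y : Vec Bool l) r d → get (toList y ++ r) (l + d) ≡ get r d
get-toList-++ʳ []ᵥ      r d = refl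
get-toList-++ʳ (x ∷ᵥ y) r d = get-toList-++ʳ y r d

T-lookup⇔∈ : ∀ {n} {S : Subset n} {u} → T (lookup S u) ⇔ u ∈ S
T-lookup⇔∈ {S = S} {u} = mk⇔ (lookup⇒[]= u S ∘ to T-≡) (from T-≡ ∘ []=⇒lookup)

T-∨-lookup⇔∈ : ∀ {n} {S : Subset n} {u v w} →
               T (lookup S u ∨ lookup S v ∨ lookup S w) ⇔ (u ∈ S ⊎ v ∈ S ⊎ w ∈ S)
T-∨-lookup⇔∈ = mk⇔
  (Sum.map (to T-lookup⇔∈) (Sum.map (to T-lookup⇔∈) (to T-lookup⇔∈)) ∘ Sum.map₂ (to T-∨) ∘ to T-∨)
  (from T-∨ ∘ Sum.map₂ (from T-∨)
            ∘ Sum.map (from T-lookup⇔∈) (Sum.map (from T-lookup⇔∈) (from T-lookup⇔∈)))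

toℕ-mod : ∀ j n .{{_ : NonZero n}} → toℕ (j mod n) ≡ j % n
toℕ-mod j n = toℕ-fromℕ< (m%n<n j n)

mod-≡ : ∀ {j n} .{{_ : NonZero n}} {u : Fin n} → toℕ u ≡ j % n → j mod n ≡ u
mod-≡ {j} {n} eq = toℕ-injective (trans (toℕ-mod j n) (sym eq))

suc-%-% : ∀ x n .{{_ : NonZero n}} → suc (x % n) % n ≡ suc x % n
suc-%-% x n = begin
  (1 + x % n) % n           ≡⟨ %-distribˡ-+ 1 (x % n) n ⟩
  (1 % n + x % n % n) % n   ≡⟨ cong (λ y → (1 % n + y) % n) (m%n%n≡m%n x n) ⟩
  (1 % n + x % n) % n       ≡⟨ %-distribˡ-+ 1 x n ⟨
  (1 + x) % n               ∎

suc-%-injective : ∀ {x y n} .{{_ : NonZero n}} → x < n → y < n → suc x % n ≡ suc y % n → x ≡ y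
suc-%-injective {x} {y} {n} x<n y<n eq with m≤n⇒m<n∨m≡n x<n | m≤n⇒m<n∨m≡n y<n
... | inj₁ sx<n | inj₁ sy<n =
  suc-injective (trans (sym (m<n⇒m%n≡m sx<n)) (trans eq (m<n⇒m%n≡m sy<n)))
... | inj₂ sx≡n | inj₂ sy≡n = suc-injective (trans sx≡n (sym sy≡n))
... | inj₁ sx<n | inj₂ sy≡n
  with () ← trans (sym (m<n⇒m%n≡m sx<n)) (trans eq (trans (%-congˡ sy≡n) (n%n≡0 n)))
... | inj₂ sx≡n | inj₁ sy<n
  with () ← trans (sym (m<n⇒m%n≡m sy<n)) (trans (sym eq) (trans (%-congˡ sx≡n) (n%n≡0 n)))

cyclic-pred : ∀ {k v} → v < suc k → ∃ λ j → j < suc k × suc j % suc k ≡ v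
cyclic-pred {k} {zero}  _           = k , ≤-refl , n%n≡0 (suc k)
cyclic-pred {k} {suc v} (s≤s v<k)   = v , m<n⇒m<1+n v<k , m<n⇒m%n≡m (s≤s v<k)

-- Dominating sets of cycles as cyclic words

module _ {k : ℕ} (S : Subset (suc k)) where

  CyclicWindow : ℕ → Set
  CyclicWindow j = j mod suc k ∈ S ⊎ (1 + j) mod suc k ∈ S ⊎ (2 + j) mod suc k ∈ S

  dominating⇒windows : IsDominating (suc k) S → ∀ {j} → j < suc k → CyclicWindow j
  dominating⇒windows dom {j} j<n with (1 + j) mod suc k ∈? S
  ... | yes c∈S = inj₂ (inj₁ c∈S)
  ... | no  c∉S with dom ((1 + j) mod suc k) c∉S
  ...   | u , inj₁ next[u]≡c , u∈S = inj₁ (subst (_∈ S) (sym (mod-≡ {j} u≡j)) u∈S)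
    where
    u≡j : toℕ u ≡ j % suc k
    u≡j = trans (suc-%-injective (toℕ<n u) j<n (trans next[u]≡c (toℕ-mod (1 + j) (suc k))))
                (sym (m<n⇒m%n≡m j<n))
  ...   | u , inj₂ next[c]≡u , u∈S = inj₂ (inj₂ (subst (_∈ S) (sym (mod-≡ {2 + j} u≡2+j)) u∈S))
    where
    u≡2+j : toℕ u ≡ (2 + j) % suc k
    u≡2+j = trans (sym next[c]≡u)
                  (trans (cong (λ c → suc c % suc k) (toℕ-mod (1 + j) (suc k))) (suc-%-% (1 + j) (suc k)))

  windows⇒dominating : (∀ {j} → j < suc k → CyclicWindow j) → IsDominating (suc k) S
  windows⇒dominating win v v∉S with cyclic-pred (toℕ<n v)
  ... | j , j<n , next[j]≡v with win j<n
  ...   | inj₁ j∈S = j mod suc k , inj₁ next[j]≡v′ , j∈S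
    where
    next[j]≡v′ : suc (toℕ (j mod suc k)) % suc k ≡ toℕ v
    next[j]≡v′ = trans (cong (λ i → suc i % suc k) (toℕ-mod j (suc k)))
                       (trans (suc-%-% j (suc k)) next[j]≡v)
  ...   | inj₂ (inj₁ 1+j∈S) =
    contradiction (subst (_∈ S) (mod-≡ {1 + j} (sym next[j]≡v)) 1+j∈S) v∉S
  ...   | inj₂ (inj₂ 2+j∈S) = (2 + j) mod suc k , inj₂ next[v]≡2+j , 2+j∈S
    where
    next[v]≡2+j : suc (toℕ v) % suc k ≡ toℕ ((2 + j) mod suc k)
    next[v]≡2+j = trans (cong (λ i → suc i % suc k) (sym next[j]≡v))
                        (trans (suc-%-% (1 + j) (suc k)) (sym (toℕ-mod (2 + j) (suc k))))

  dominating⇔windows : IsDominating (suc k) S ⇔ (∀ {j} → j < suc k → CyclicWindow j)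
  dominating⇔windows = mk⇔ dominating⇒windows windows⇒dominating

wrap : ∀ {m} → Subset (2 + m) → List Bool
wrap S = toList S ++ lookup S fzero ∷ lookup S (fsuc fzero) ∷ []

n+d%n≡d : ∀ {n d} .{{_ : NonZero n}} → d < n → (n + d) % n ≡ d
n+d%n≡d {n} {d} d<n = trans (%-congˡ (+-comm n d)) (trans ([m+n]%n≡m%n d n) (m<n⇒m%n≡m d<n))

module _ {m : ℕ} (S : Subset (2 + m)) where

  length-wrap : length (wrap S) ≡ 2 + (2 + m)
  length-wrap = trans (length-++ (toList S)) (trans (cong (_+ 2) (length-toList S)) (+-comm (2 + m) 2))

  get-wrap : ∀ {j} → j < 2 + (2 + m) → get (wrap S) j ≡ lookup S (j mod (2 + m))
  get-wrap {j} j<2+n with j <? 2 + m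
  ... | yes j<n = trans (cong (get (wrap S)) (sym (trans (toℕ-mod j (2 + m)) (m<n⇒m%n≡m j<n))))
                        (get-toList-++ˡ S _ (j mod (2 + m)))
  ... | no  j≮n = subst (λ i → get (wrap S) i ≡ lookup S (i mod (2 + m)))
                        (m+[n∸m]≡n (≮⇒≥ j≮n))
                        (overflow (m<n+o⇒m∸n<o j (2 + m) (subst (j <_) (+-comm 2 (2 + m)) j<2+n)))
    where
    lookup-overflow : (u : Fin (2 + m)) → lookup S u ≡ lookup S (((2 + m) + toℕ u) mod (2 + m))
    lookup-overflow u = cong (lookup S) (sym (mod-≡ {(2 + m) + toℕ u} (sym (n+d%n≡d {2 + m} (toℕ<n u)))))
    overflow : ∀ {d} → d < 2 → get (wrap S) ((2 + m) + d) ≡ lookup S (((2 + m) + d) mod (2 + m))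
    overflow {zero}        _ = trans (get-toList-++ʳ S _ 0) (lookup-overflow fzero)
    overflow {suc zero}    _ = trans (get-toList-++ʳ S _ 1) (lookup-overflow (fsuc fzero))
    overflow {suc (suc _)} (s≤s (s≤s ()))

  window-wrap : ∀ {j} → j < 2 + m → T (window (wrap S) j) ⇔ CyclicWindow S j
  window-wrap {j} j<n = subst (λ b → T b ⇔ CyclicWindow S j) (sym wrapped) T-∨-lookup⇔∈
    where
    wrapped : window (wrap S) j ≡ lookup S (j mod (2 + m)) ∨ lookup S ((1 + j) mod (2 + m))
                                                          ∨ lookup S ((2 + j) mod (2 + m))
    wrapped = cong₂ _∨_ (get-wrap (m<n⇒m<1+n (m<n⇒m<1+n j<n)))
                        (cong₂ _∨_ (get-wrap (s≤s (m<n⇒m<1+n j<n))) (get-wrap (s≤s (s≤s j<n))))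

  covered⇔windows : Covered (wrap S) ⇔ (∀ {j} → j < 2 + m → CyclicWindow S j)
  covered⇔windows = mk⇔
    (λ cov {j} j<n → to (window-wrap j<n)
                          (covered⇒window (wrap S) cov (subst (_ ≤_) (sym length-wrap) (s≤s (s≤s j<n)))))
    (λ win → window⇒covered (wrap S) λ {j} le →
       let j<n = ≤-pred (≤-pred (subst (_ ≤_) length-wrap le)) in from (window-wrap j<n) (win j<n))

  dominating⇔covered : IsDominating (2 + m) S ⇔ Covered (wrap S)
  dominating⇔covered = ⇔-trans (dominating⇔windows S) (⇔-sym covered⇔windows)

length-filter-map : ∀ {A B : Set} {P : B → Set} (P? : Decidable P) (f : A → B) xs →
                    length (filter P? (map f xs)) ≡ length (filter (P? ∘ f) xs)
length-filter-map P? f []       = refl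
length-filter-map P? f (x ∷ xs) with P? (f x)
... | yes _ = cong suc (length-filter-map P? f xs)
... | no  _ = length-filter-map P? f xs

weighted : ∀ {n} {P : Subset n → Set} → Decidable P → List (Subset n) → Poly
weighted P? Ss i = length (filter (λ S → P? S ×-dec (∣ S ∣ ≟ i)) Ss)

module _ {n} {P : Subset n → Set} (P? : Decidable P) where

  weighted-++ : ∀ xs ys i → weighted P? (xs ++ ys) i ≡ weighted P? xs i + weighted P? ys i
  weighted-++ xs ys i = trans (cong length (filter-++ _ xs ys)) (length-++ (filter _ xs))

  weighted-∅ : (∀ S → ¬ P S) → ∀ Ss i → weighted P? Ss i ≡ 0
  weighted-∅ ¬P Ss i = cong length (filter-none _ (All.universal (λ S → ¬P S ∘ proj₁) Ss))

  weighted-≐ : ∀ {Q : Subset n → Set} (Q? : Decidable Q) → P ≐ Q →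
               ∀ Ss → weighted P? Ss ≗ weighted Q? Ss
  weighted-≐ Q? (P⊆Q , Q⊆P) Ss i =
    cong length (filter-≐ _ _ (Product.map₁ P⊆Q , Product.map₁ Q⊆P) Ss)

module _ {m} {P : Subset (suc m) → Set} (P? : Decidable P) where

  weighted-split : ∀ i → weighted P? (allSubsets (suc m)) i
                       ≡ shift 1 (weighted (P? ∘ (inside ∷ᵥ_)) (allSubsets m)) i
                         + weighted (P? ∘ (outside ∷ᵥ_)) (allSubsets m) i
  weighted-split i = trans (weighted-++ P? (map (inside ∷ᵥ_) Ss) (map (outside ∷ᵥ_) Ss) i)
                           (cong₂ _+_ (trans (length-filter-map _ (inside ∷ᵥ_) Ss) (insideShifted i))
                                      (length-filter-map _ (outside ∷ᵥ_) Ss))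
    where
    Ss = allSubsets m
    insideShifted : ∀ i → length (filter (λ y → P? (inside ∷ᵥ y) ×-dec (suc ∣ y ∣ ≟ i)) Ss)
                      ≡ shift 1 (weighted (P? ∘ (inside ∷ᵥ_)) Ss) i
    insideShifted zero    = cong length (filter-none _ (All.universal (λ _ ()) Ss))
    insideShifted (suc i) =
      cong length (filter-≐ _ _ (Product.map₂ suc-injective , Product.map₂ (cong suc)) Ss)

framing? : ∀ p q a b {m} → Decidable λ (y : Subset m) → Covered (p ∷ q ∷ toList y ++ a ∷ b ∷ [])
framing? p q a b y = covered? (p ∷ q ∷ toList y ++ a ∷ b ∷ [])

framed : Bool → Bool → Bool → Bool → Series
framed p q a b m = weighted (framing? p q a b) (allSubsets m)

covered-second-true : ∀ p q w → Covered (p ∷ true ∷ w) → Covered (q ∷ true ∷ w)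
covered-second-true p q []      _         = tt
covered-second-true p q (x ∷ w) (_ , cov) = from T-∨ (inj₂ tt) , cov

module _ (a b : Bool) where

  framed-second-true : ∀ p m → framed p true a b m ≗ framed true true a b m
  framed-second-true p m = weighted-≐ (framing? p true a b) (framing? true true a b)
    (covered-second-true p true _ , covered-second-true true p _) (allSubsets m)

  framed-drop : ∀ p q x m → T (p ∨ q ∨ x) →
                weighted (framing? p q a b ∘ (x ∷ᵥ_)) (allSubsets m) ≗ framed q x a b m
  framed-drop p q x m first = weighted-≐ (framing? p q a b ∘ (x ∷ᵥ_)) (framing? q x a b)
                                         (proj₂ , (first ,_)) (allSubsets m)

  framed-true-suc : ∀ q m i → framed true q a b (suc m) i
                             ≡ shift 1 (framed q true a b m) i + framed q false a b m i
  framed-true-suc q m i = trans (weighted-split {m} (framing? true q a b) i)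
    (cong₂ _+_ (shift-cong 1 (framed-drop true q true m tt) i) (framed-drop true q false m tt i))

  framed-false-false-suc : ∀ m → framed false false a b (suc m) ≗ shift 1 (framed true true a b m)
  framed-false-false-suc m i = begin
    framed false false a b (suc m) i
      ≡⟨ weighted-split {m} (framing? false false a b) i ⟩
    shift 1 (weighted (framing? false false a b ∘ (inside ∷ᵥ_)) (allSubsets m)) i
      + weighted (framing? false false a b ∘ (outside ∷ᵥ_)) (allSubsets m) i
      ≡⟨ cong₂ _+_ (shift-cong 1 (λ j → trans (framed-drop false false true m tt j)
                                              (framed-second-true false m j)) i)
                   (weighted-∅ (framing? false false a b ∘ (outside ∷ᵥ_)) (λ _ → proj₁)
                               (allSubsets m) i) ⟩
    shift 1 (framed true true a b m) i + 0
      ≡⟨ +-identityʳ _ ⟩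
    shift 1 (framed true true a b m) i ∎

  framed-true-false-suc : ∀ m → framed true false a b (suc m)
                                ≗ λ i → shift 1 (framed true true a b m) i + framed false false a b m i
  framed-true-false-suc m i = trans (framed-true-suc false m i)
                                    (cong (_+ framed false false a b m i) (shift-cong 1 (framed-second-true false m) i))

  rec-framed : RecFrom 0 (framed true true a b)
  rec-framed = recFrom λ {m} _ i → begin
    t (3 + m) i
      ≡⟨ framed-true-suc true (2 + m) i ⟩
    shift 1 (t (2 + m)) i + framed true false a b (2 + m) i
      ≡⟨ cong (shift 1 (t (2 + m)) i +_) (framed-true-false-suc (1 + m) i) ⟩
    shift 1 (t (2 + m)) i + (shift 1 (t (1 + m)) i + framed false false a b (1 + m) i)
      ≡⟨ cong (λ x → shift 1 (t (2 + m)) i + (shift 1 (t (1 + m)) i + x)) (framed-false-false-suc m i) ⟩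
    shift 1 (t (2 + m)) i + (shift 1 (t (1 + m)) i + shift 1 (t m) i)
      ≡⟨ sum₃-v^ 1 t m i ⟨
    shift 1 (sum₃ t m) i ∎
    where
    t = framed true true a b

dominating-framed : ∀ a b m → weighted (λ y → isDominating? (2 + m) (a ∷ᵥ b ∷ᵥ y)) (allSubsets m)
                              ≗ framed a b a b m
dominating-framed a b m =
  weighted-≐ (λ y → isDominating? (2 + m) (a ∷ᵥ b ∷ᵥ y)) (framing? a b a b)
             ( (λ {y} → to (dominating⇔covered (a ∷ᵥ b ∷ᵥ y)))
             , (λ {y} → from (dominating⇔covered (a ∷ᵥ b ∷ᵥ y))))
             (allSubsets m)

numDominatingSets-split : ∀ m i → numDominatingSets (2 + m) i
  ≡ shift 1 (λ j → shift 1 (framed true true true true m) j + framed true false true false m j) i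
    + (shift 1 (framed false true false true m) i + framed false false false false m i)
numDominatingSets-split m i =
  trans (weighted-split {1 + m} (isDominating? (2 + m)) i)
        (cong₂ _+_ (shift-cong 1 (λ j → trans (weighted-split {m} (second true) j)
                                               (cong₂ _+_ (shift-cong 1 (dominating-framed true true m) j)
                                                          (dominating-framed true false m j))) i)
                   (trans (weighted-split {m} (second false) i)
                          (cong₂ _+_ (shift-cong 1 (dominating-framed false true m) i)
                                     (dominating-framed false false m i))))
  where
  second : ∀ a → Decidable λ y → IsDominating (2 + m) (a ∷ᵥ y)
  second a y = isDominating? (2 + m) (a ∷ᵥ y)

cycleTerms : Series
cycleTerms = v^ 1 · (u^ 2 · v^ 1 · framed true true true true
                     ⊕ (u^ 3 · v^ 1 · framed true true true false
                        ⊕ u^ 4 · v^ 1 · framed true true true false))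
           ⊕ (u^ 2 · v^ 1 · framed true true false true
              ⊕ u^ 3 · v^ 1 · framed true true false false)

numDominatingSets≗cycleTerms : ∀ {n} → 4 ≤ n → numDominatingSets n ≗ cycleTerms n
numDominatingSets≗cycleTerms (s≤s (s≤s (s≤s (s≤s {n = k} _)))) i =
  trans (numDominatingSets-split (2 + k) i)
        (cong₂ _+_ (shift-cong 1 (λ j → cong (shift 1 (framed true true true true (2 + k)) j +_)
                                             (split₁₀ j)) i)
                   (cong₂ _+_ (shift-cong 1 (framed-second-true false true false (2 + k)) i)
                              (framed-false-false-suc false false (1 + k) i)))
  where
  t₁₀ = framed true true true false
  split₁₀ : framed true false true false (2 + k) ≗
            λ j → shift 1 (t₁₀ (1 + k)) j + shift 1 (t₁₀ k) j
  split₁₀ j = trans (framed-true-false-suc true false (1 + k) j)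
                    (cong (shift 1 (t₁₀ (1 + k)) j +_) (framed-false-false-suc true false k j))

rec-cycleTerms : RecFrom 4 cycleTerms
rec-cycleTerms =
  rec-⊕ (rec-v^ 1 (rec-⊕ (rec-u^ 2 (rec-v^ 1 (rec-framed true true)))
                         (rec-⊕ (rec-u^ 3 (rec-v^ 1 (rec-framed true false)))
                                (rec-u^ 4 (rec-v^ 1 (rec-framed true false))))))
        (rec-⊕ (rec-u^ 2 (rec-v^ 1 (rec-framed false true)))
               (rec-u^ 3 (rec-v^ 1 (rec-framed false false))))

≗-from-table : ∀ k {f g : ℕ → ℕ} → (∀ (i : Fin k) → f (toℕ i) ≡ g (toℕ i)) →
               (∀ j → f (k + j) ≡ g (k + j)) → f ≗ g
≗-from-table zero    _     above i       = above i
≗-from-table (suc k) below above zero    = below fzero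
≗-from-table (suc k) below above (suc i) = ≗-from-table k (below ∘ fsuc) above i

agree? : ∀ n → Dec (∀ (i : Fin 9) → cycleTerms n (toℕ i) ≡ mul numerTerms trib n (toℕ i))
agree? n = all? λ i → cycleTerms n (toℕ i) ≟ mul numerTerms trib n (toℕ i)

-- Both sides vanish beyond v^8 here, so nine coefficients decide each case.
small-cases : ∀ {n} → 4 ≤ n → n < 9 → cycleTerms n ≗ mul numerTerms trib n
small-cases {0} () _
small-cases {1} (s≤s ()) _
small-cases {2} (s≤s (s≤s ())) _
small-cases {3} (s≤s (s≤s (s≤s ()))) _
small-cases {4} _ _ = ≗-from-table 9 (from-yes (agree? 4)) (λ _ → refl)
small-cases {5} _ _ = ≗-from-table 9 (from-yes (agree? 5)) (λ _ → refl)
small-cases {6} _ _ = ≗-from-table 9 (from-yes (agree? 6)) (λ _ → refl)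
small-cases {7} _ _ = ≗-from-table 9 (from-yes (agree? 7)) (λ _ → refl)
small-cases {8} _ _ = ≗-from-table 9 (from-yes (agree? 8)) (λ _ → refl)
small-cases {suc (suc (suc (suc (suc (suc (suc (suc (suc n))))))))} _ n<9 =
  contradiction n<9 (≤⇒≯ (m≤m+n 9 n))

-- The identity holds for every i.
theorem3 : (n i : ℕ) → 4 ≤ n → (n + 2) / 3 ≤ i → i ≤ n →
           numDominatingSets n i ≡ fSeries n i
theorem3 n i 4≤n _ _ = begin
  numDominatingSets n i    ≡⟨ numDominatingSets≗cycleTerms 4≤n i ⟩
  cycleTerms n i
    ≡⟨ rec-unique 4≤6 (RecFrom-mono 4≤6 rec-cycleTerms) rec-numer small-cases n 4≤n i ⟩
  mul numerTerms trib n i  ≡⟨ fSeries-expand n i ⟨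
  fSeries n i              ∎
  where
  4≤6 : 4 ≤ 6
  4≤6 = s≤s (s≤s (s≤s (s≤s z≤n)))
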